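{- Let $k\geq 2$ and $n\ge 1$. There is a codebreaker procedure using $n+1$ black-peg queries which, for every hidden codeword $c\in[k]^n$, finds a string $z\in[k]^n$ with $b_c(z)=0$.
   Context: Black-peg Mastermind with $k$ colors and $n$ positions: a hidden codeword $c\in[k]^n$; for a query $q\in[k]^n$ the answer is $b_c(q)=|\{i\in[n]: q_i=c_i\}|$. -}

module Defs where

open import Data.Nat using (ℕ; zero; suc; _+_)
open import Data.Fin using (Fin)
open import Data.Fin.Properties using (_≟_)
open import Data.Vec using (Vec; []; _∷_)
open import Relation.Nullary using (yes; no)

Word : ℕ → ℕ → Set
Word k n = Vec (Fin k) n

black : ∀ {k n} → Word k n → Word k n → ℕ
black [] [] = 0
black (c ∷ cs) (q ∷ qs) with c ≟ q
... | yes _ = suc (black cs qs)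
... | no  _ = black cs qs

-- An adaptive codebreaker procedure using at most m queries:
-- a decision tree that either outputs a string, or asks a query and
-- continues depending on the (numeric) answer, with one query less.
data Strategy (k n : ℕ) : ℕ → Set where
  output : ∀ {m} → Word k n → Strategy k n m
  ask    : ∀ {m} → Word k n → (ℕ → Strategy k n m) → Strategy k n (suc m)

run : ∀ {k n m} → Strategy k n m → Word k n → Word k n
run (output z) c = z
run (ask q f)  c = run (f (black c q)) c

-- Query 0ⁿ to learn the number a of zeros of c. Then, for each position i,
-- query the word with 1 at i and 0 elsewhere: its answer is a − 1 exactly
-- when cᵢ = 0 (it is a or a + 1 otherwise). Output 1 where cᵢ = 0 and 0
-- elsewhere. The recursion below handles one position at a time, playing the
-- rest of the procedure on the tail with the head's known contribution
-- subtracted from every answer.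
module Submission where

open import Defs
open import Data.Bool using (if_then_else_)
open import Data.Fin using (Fin; zero; suc)
open import Data.Nat using (ℕ; zero; suc; pred; _+_; _∸_; _≤_; s≤s; _≟_)
open import Data.Nat.Properties using (m+n∸m≡n; 1+n≢n; m+1+n≢n)
open import Data.Product using (Σ; _,_)
open import Data.Vec using ([]; _∷_; replicate)
open import Relation.Binary.PropositionalEquality using (_≡_; refl)
open import Relation.Nullary.Decidable using (does; dec-true; dec-false)

module _ {k : ℕ} where

  prepend : ∀ {n m} → (query-head : Fin k) (answer-shift : ℕ) (output-head : Fin k) →
            Strategy k n m → Strategy k (suc n) m
  prepend z d x (output w) = output (x ∷ w)
  prepend z d x (ask q f)  = ask (z ∷ q) (λ r → prepend z d x (f (r ∸ d)))

  run-prepend : ∀ {n m} z d x (S : Strategy k n m) c (cs : Word k n) →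
                (∀ q → black (c ∷ cs) (z ∷ q) ≡ d + black cs q) →
                run (prepend z d x S) (c ∷ cs) ≡ x ∷ run S cs
  run-prepend z d x (output w) c cs head-adds-d = refl
  run-prepend z d x (ask q f)  c cs head-adds-d
    rewrite head-adds-d q | m+n∸m≡n d (black cs q) =
    run-prepend z d x (f (black cs q)) c cs head-adds-d

module _ {k : ℕ} where

  zeros : (n : ℕ) → Word (suc (suc k)) n
  zeros n = replicate n zero

  -- The second argument is the number of zeros of the hidden word.
  avoid : (n : ℕ) → ℕ → Strategy (suc (suc k)) n n
  avoid zero    a = output []
  avoid (suc n) a = ask (suc zero ∷ zeros n) λ r →
    if does (suc r ≟ a)
      then prepend zero 1 (suc zero) (avoid n (pred a))
      else prepend zero 0 zero (avoid n a)

  avoid-correct : ∀ n (c : Word (suc (suc k)) n) →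
                  black c (run (avoid n (black c (zeros n))) c) ≡ 0
  avoid-correct zero [] = refl
  avoid-correct (suc n) (zero ∷ cs)
    rewrite dec-true (suc (black cs (zeros n)) ≟ suc (black cs (zeros n))) refl
          | run-prepend zero 1 (suc zero) (avoid n (black cs (zeros n))) zero cs (λ q → refl)
    = avoid-correct n cs
  avoid-correct (suc n) (suc zero ∷ cs)
    rewrite dec-false (suc (suc (black cs (zeros n))) ≟ black cs (zeros n)) (m+1+n≢n 1)
          | run-prepend zero 0 zero (avoid n (black cs (zeros n))) (suc zero) cs (λ q → refl)
    = avoid-correct n cs
  avoid-correct (suc n) (suc (suc c) ∷ cs)
    rewrite dec-false (suc (black cs (zeros n)) ≟ black cs (zeros n)) 1+n≢n
          | run-prepend zero 0 zero (avoid n (black cs (zeros n))) (suc (suc c)) cs (λ q → refl)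
    = avoid-correct n cs

lemma1 : (k n : ℕ) → 2 ≤ k → 1 ≤ n →
         Σ (Strategy k n (suc n)) (λ S → (c : Word k n) → black c (run S c) ≡ 0)
lemma1 .(suc (suc k)) n (s≤s (s≤s {n = k} _)) _ =
  ask (zeros n) (avoid n) , λ c → avoid-correct n c
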